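{- Let $p$ be a prime and let $h,a\in\{1,\ldots,p-1\}$ satisfy $\gcd(h,a,p-1)=1$. Then $h^{h}\equiv a^{a}\pmod p$ if and only if there exists $g\in\{1,\ldots,p-1\}$ with \[ g^{h}\equiv a\pmod p\quad\text{and}\quad g^{a}\equiv h\pmod p, \] and in that case such a $g$ is unique. Consequently, restricted to $\gcd(h,a,p-1)=1$, the map $(g,h,a)\mapsto(h,a)$ is a bijection from the set of triples satisfying the two congruences above to the set of pairs satisfying $h^h\equiv a^a\pmod p$. In particular this holds whenever $\gcd(h,p-1)=1$ or $\gcd(a,p-1)=1$. -}

module Defs where

open import Data.Nat using (ℕ; _≤_; _∸_; _^_)
open import Data.Nat.GCD using (gcd)
open import Data.Integer as ℤ using (ℤ; +_)
open import Data.Integer.Divisibility using (_∣_)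
open import Data.Product using (_×_)
open import Relation.Binary.PropositionalEquality using (_≡_)

_≡_[mod_] : ℕ → ℕ → ℕ → Set
x ≡ y [mod m ] = (+ m) ∣ ((+ x) ℤ.- (+ y))

InUnits : ℕ → ℕ → Set
InUnits p x = (1 ≤ x) × (x ≤ p ∸ 1)

Gcd3One : ℕ → ℕ → ℕ → Set
Gcd3One h a p = gcd (gcd h a) (p ∸ 1) ≡ 1

Triple : ℕ → ℕ → ℕ → ℕ → Set
Triple p g h a = ((g ^ h) ≡ a [mod p ]) × ((g ^ a) ≡ h [mod p ])

module Submission where

-- Write c = p ∸ 1. By Fermat's little theorem the exponent of a unit only matters modulo c, and
-- gcd (h, a, c) = 1 gives natural numbers u, v with u h + v a ≡ 1 (mod c). Hence every unit x
-- satisfies x ≡ (x ^ h) ^ u (x ^ a) ^ v, so a unit g is determined by g ^ h and g ^ a, which gives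
-- uniqueness. If h ^ h ≡ a ^ a then g = a ^ u h ^ v works: g ^ h = (a ^ h) ^ u (h ^ h) ^ v ≡
-- (a ^ h) ^ u (a ^ a) ^ v ≡ a, and symmetrically g ^ a ≡ h. Conversely h ^ h ≡ g ^ (a h) ≡ a ^ a.
-- Fermat's theorem itself follows from (x + 1) ^ p ≡ x ^ p + 1, as p divides every inner binomial
-- coefficient of p.

import Algebra.Properties.CommutativeSemiring.Binomial
import Algebra.Properties.Monoid.Sum
import Algebra.Properties.Semiring.Exp
import Algebra.Properties.Semiring.Mult
open import Data.Fin.Base using (Fin; zero; suc; toℕ; fromℕ; inject₁)
open import Data.Fin.Properties using (toℕ-fromℕ; toℕ-inject₁; toℕ<n)
import Data.Integer.Base as ℤ
open import Data.Integer.Divisibility.Signed as Signed using (∣ᵤ⇒∣; ∣⇒∣ᵤ)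
import Data.Integer.Properties as ℤ
import Data.Integer.Tactic.RingSolver as ℤ-Solver
open import Data.Nat.Base
  using (ℕ; zero; suc; _+_; _*_; _∸_; _^_; _≤_; _<_; ∣_-_∣; pred; _!; s≤s; z<s; NonZero; >-nonZero; nonTrivial⇒n>1)
open import Data.Nat.Combinatorics using (_C_; nCn≡1; nCk≡n!/k![n-k]!; k![n∸k]!∣n!)
open import Data.Nat.DivMod using (_%_; _/_; m≡m%n+[m/n]*n; m%n<n; m/n*n≡m)
open import Data.Nat.Divisibility
  using (_∣_; _∤_; divides; _∣0; ∣-refl; ∣-trans; n∣m*n; m∣m*n; ∣m⇒∣m*n; ∣m∣n⇒∣m+n; ∣1⇒≡1; >⇒∤)
open import Data.Nat.GCD using (gcd; gcd-GCD; gcd[m,n]∣m; gcd[m,n]∣n; gcd-greatest; module Bézout)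
open import Data.Nat.Primality
  using (Prime; euclidsLemma; ¬prime[0]; ¬prime[1]; prime⇒nonZero; prime⇒nonTrivial)
open import Data.Nat.Properties
open import Data.Nat.Tactic.RingSolver using (solve-∀)
open import Data.Product using (Σ; ∃; _×_; _,_)
open import Data.Sum using (_⊎_; inj₁; inj₂; [_,_]′)
open import Defs
open import Function.Bundles using (_⇔_; mk⇔)
open import Level using (0ℓ)
open import Relation.Binary.Bundles using (Setoid)
open import Relation.Binary.PropositionalEquality
  using (_≡_; _≢_; refl; sym; trans; cong; cong₂; subst; module ≡-Reasoning)
import Relation.Binary.Reasoning.Setoid as SetoidReasoning
open import Relation.Nullary using (contradiction)

-- Congruence modulo m

∣+m-+n∣≡∣m-n∣ : ∀ m n → ℤ.∣ ℤ.+ m ℤ.- ℤ.+ n ∣ ≡ ∣ m - n ∣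
∣+m-+n∣≡∣m-n∣ m n with ≤-total n m
... | inj₁ n≤m = begin
  ℤ.∣ ℤ.+ m ℤ.- ℤ.+ n ∣ ≡⟨ cong ℤ.∣_∣ (ℤ.m-n≡m⊖n m n) ⟩
  ℤ.∣ m ℤ.⊖ n ∣         ≡⟨ ℤ.∣m⊖n∣≡∣n⊖m∣ m n ⟩
  ℤ.∣ n ℤ.⊖ m ∣         ≡⟨ ℤ.∣⊖∣-≤ n≤m ⟩
  m ∸ n                 ≡⟨ m≤n⇒∣n-m∣≡n∸m n≤m ⟨
  ∣ m - n ∣             ∎
  where open ≡-Reasoning
... | inj₂ m≤n = begin
  ℤ.∣ ℤ.+ m ℤ.- ℤ.+ n ∣ ≡⟨ cong ℤ.∣_∣ (ℤ.m-n≡m⊖n m n) ⟩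
  ℤ.∣ m ℤ.⊖ n ∣         ≡⟨ ℤ.∣⊖∣-≤ m≤n ⟩
  n ∸ m                 ≡⟨ m≤n⇒∣m-n∣≡n∸m m≤n ⟨
  ∣ m - n ∣             ∎
  where open ≡-Reasoning

-- The congruence of Defs unfolds to an absolute value, from which Agda cannot recover
-- x and y by unification; wrapping it in a record keeps them inferable.
infix 4 _≈_[mod_]

record _≈_[mod_] (x y m : ℕ) : Set where
  constructor mod
  field unmod : x ≡ y [mod m ]

open _≈_[mod_] public

module _ {m : ℕ} where

  ≈-mod⇒∣∣-∣ : ∀ {x y} → x ≈ y [mod m ] → m ∣ ∣ x - y ∣
  ≈-mod⇒∣∣-∣ {x} {y} x≈y = subst (m ∣_) (∣+m-+n∣≡∣m-n∣ x y) (unmod x≈y)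

  ∣∣-∣⇒≈-mod : ∀ {x y} → m ∣ ∣ x - y ∣ → x ≈ y [mod m ]
  ∣∣-∣⇒≈-mod {x} {y} m∣∣x-y∣ = mod (subst (m ∣_) (sym (∣+m-+n∣≡∣m-n∣ x y)) m∣∣x-y∣)

  private
    signed : ∀ {x y} → x ≈ y [mod m ] → ℤ.+ m Signed.∣ (ℤ.+ x ℤ.- ℤ.+ y)
    signed x≈y = ∣ᵤ⇒∣ (unmod x≈y)

    unsigned : ∀ {x y} → ℤ.+ m Signed.∣ (ℤ.+ x ℤ.- ℤ.+ y) → x ≈ y [mod m ]
    unsigned m∣x-y = mod (∣⇒∣ᵤ m∣x-y)

  ≈-mod-refl : ∀ {x} → x ≈ x [mod m ]
  ≈-mod-refl {x} = ∣∣-∣⇒≈-mod (subst (m ∣_) (sym (∣n-n∣≡0 x)) (m ∣0))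

  ≡⇒≈-mod : ∀ {x y} → x ≡ y → x ≈ y [mod m ]
  ≡⇒≈-mod refl = ≈-mod-refl

  ≈-mod-sym : ∀ {x y} → x ≈ y [mod m ] → y ≈ x [mod m ]
  ≈-mod-sym {x} {y} x≈y = ∣∣-∣⇒≈-mod (subst (m ∣_) (∣-∣-comm x y) (≈-mod⇒∣∣-∣ x≈y))

  ≈-mod-trans : ∀ {x y z} → x ≈ y [mod m ] → y ≈ z [mod m ] → x ≈ z [mod m ]
  ≈-mod-trans {x} {y} {z} x≈y y≈z = unsigned (subst (ℤ.+ m Signed.∣_)
    (telescope (ℤ.+ x) (ℤ.+ y) (ℤ.+ z)) (Signed.∣m∣n⇒∣m+n (signed x≈y) (signed y≈z)))
    where
    telescope : ∀ i j k → (i ℤ.- j) ℤ.+ (j ℤ.- k) ≡ i ℤ.- k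
    telescope = ℤ-Solver.solve-∀

  ≈-mod-setoid : Setoid 0ℓ 0ℓ
  ≈-mod-setoid = record
    { Carrier       = ℕ
    ; _≈_           = _≈_[mod m ]
    ; isEquivalence = record { refl = ≈-mod-refl ; sym = ≈-mod-sym ; trans = ≈-mod-trans }
    }

  +-cong-mod : ∀ {x y z w} → x ≈ y [mod m ] → z ≈ w [mod m ] → x + z ≈ y + w [mod m ]
  +-cong-mod {x} {y} {z} {w} x≈y z≈w =
    unsigned (subst (ℤ.+ m Signed.∣_) eq (Signed.∣m∣n⇒∣m+n (signed x≈y) (signed z≈w)))
    where
    rearrange : ∀ i j k l → (i ℤ.- j) ℤ.+ (k ℤ.- l) ≡ (i ℤ.+ k) ℤ.- (j ℤ.+ l)
    rearrange = ℤ-Solver.solve-∀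
    eq : (ℤ.+ x ℤ.- ℤ.+ y) ℤ.+ (ℤ.+ z ℤ.- ℤ.+ w) ≡ ℤ.+ (x + z) ℤ.- ℤ.+ (y + w)
    eq rewrite ℤ.pos-+ x z | ℤ.pos-+ y w = rearrange (ℤ.+ x) (ℤ.+ y) (ℤ.+ z) (ℤ.+ w)

  *-cong-mod : ∀ {x y z w} → x ≈ y [mod m ] → z ≈ w [mod m ] → x * z ≈ y * w [mod m ]
  *-cong-mod {x} {y} {z} {w} x≈y z≈w = unsigned (subst (ℤ.+ m Signed.∣_) eq
    (Signed.∣m∣n⇒∣m+n (Signed.∣m⇒∣m*n (ℤ.+ z) (signed x≈y)) (Signed.∣n⇒∣m*n (ℤ.+ y) (signed z≈w))))
    where
    rearrange : ∀ i j k l → (i ℤ.- j) ℤ.* k ℤ.+ j ℤ.* (k ℤ.- l) ≡ i ℤ.* k ℤ.- j ℤ.* l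
    rearrange = ℤ-Solver.solve-∀
    eq : (ℤ.+ x ℤ.- ℤ.+ y) ℤ.* ℤ.+ z ℤ.+ ℤ.+ y ℤ.* (ℤ.+ z ℤ.- ℤ.+ w) ≡ ℤ.+ (x * z) ℤ.- ℤ.+ (y * w)
    eq rewrite ℤ.pos-* x z | ℤ.pos-* y w = rearrange (ℤ.+ x) (ℤ.+ y) (ℤ.+ z) (ℤ.+ w)

  ^-congˡ-mod : ∀ {x y} n → x ≈ y [mod m ] → x ^ n ≈ y ^ n [mod m ]
  ^-congˡ-mod zero    x≈y = ≈-mod-refl
  ^-congˡ-mod (suc n) x≈y = *-cong-mod x≈y (^-congˡ-mod n x≈y)

  ∣⇒≈0-mod : ∀ {x} → m ∣ x → x ≈ 0 [mod m ]
  ∣⇒≈0-mod {x} m∣x = ∣∣-∣⇒≈-mod (subst (m ∣_) (sym (∣-∣-identityʳ x)) m∣x)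

  ≈0-mod⇒∣ : ∀ {x} → x ≈ 0 [mod m ] → m ∣ x
  ≈0-mod⇒∣ {x} x≈0 = subst (m ∣_) (∣-∣-identityʳ x) (≈-mod⇒∣∣-∣ x≈0)

  +-*-≈-mod : ∀ x k → x + k * m ≈ x [mod m ]
  +-*-≈-mod x k =
    ∣∣-∣⇒≈-mod (subst (m ∣_) (trans (sym (∣m-m+n∣≡n x (k * m))) (∣-∣-comm x (x + k * m))) (n∣m*n k))

  ≈-mod⇒≡+* : ∀ {i j} → j ≤ i → i ≈ j [mod m ] → ∃ λ k → i ≡ j + k * m
  ≈-mod⇒≡+* {i} {j} j≤i i≈j with ≈-mod⇒∣∣-∣ i≈j
  ... | divides k ∣i-j∣≡k*m = k , (begin
    i             ≡⟨ m+[n∸m]≡n j≤i ⟨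
    j + (i ∸ j)   ≡⟨ cong (j +_) (m≤n⇒∣n-m∣≡n∸m j≤i) ⟨
    j + ∣ i - j ∣ ≡⟨ cong (j +_) ∣i-j∣≡k*m ⟩
    j + k * m     ∎)
    where open ≡-Reasoning

  ≈-mod⇒≡ : ∀ {x y} → x < m → y < m → x ≈ y [mod m ] → x ≡ y
  ≈-mod⇒≡ {x} {y} x<m y<m x≈y with ∣ x - y ∣ in eq
  ... | zero  = ∣m-n∣≡0⇒m≡n eq
  ... | suc d = contradiction (subst (m ∣_) eq (≈-mod⇒∣∣-∣ x≈y)) (>⇒∤ 1+d<m)
    where
    1+d<m : suc d < m
    1+d<m = subst (_< m) eq (≤-<-trans (∣m-n∣≤m⊔n x y) (⊔-lub x<m y<m))

  %-≈-mod : ∀ x .{{_ : NonZero m}} → x % m ≈ x [mod m ]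
  %-≈-mod x = ≈-mod-sym (≈-mod-trans (≡⇒≈-mod (m≡m%n+[m/n]*n x m)) (+-*-≈-mod (x % m) (x / m)))

-- Fermat's little theorem

n∣n! : ∀ n .{{_ : NonZero n}} → n ∣ n !
n∣n! (suc n) = m∣m*n (n !)

nCk*[k!*[n∸k]!]≡n! : ∀ {n k} → k ≤ n → (n C k) * (k ! * (n ∸ k) !) ≡ n !
nCk*[k!*[n∸k]!]≡n! {n} {k} k≤n =
  trans (cong (_* (k ! * (n ∸ k) !)) (nCk≡n!/k![n-k]! k≤n)) (m/n*n≡m (k![n∸k]!∣n! k≤n))
  where instance _ = k !* (n ∸ k) !≢0

module _ {p : ℕ} (p-prime : Prime p) where

  prime∤1 : p ∤ 1
  prime∤1 p∣1 = ¬prime[1] (subst Prime (∣1⇒≡1 p∣1) p-prime)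

  prime∤* : ∀ {m n} → p ∤ m → p ∤ n → p ∤ m * n
  prime∤* {m} {n} p∤m p∤n p∣m*n = [ p∤m , p∤n ]′ (euclidsLemma m n p-prime p∣m*n)

  prime∤^ : ∀ {m} → p ∤ m → ∀ n → p ∤ m ^ n
  prime∤^ p∤m zero    = prime∤1
  prime∤^ p∤m (suc n) = prime∤* p∤m (prime∤^ p∤m n)

  prime∤! : ∀ {n} → n < p → p ∤ n !
  prime∤! {zero}  _     = prime∤1
  prime∤! {suc n} 1+n<p = prime∤* (>⇒∤ 1+n<p) (prime∤! (<-trans (n<1+n n) 1+n<p))

  -- p divides p! = (p C k) * k! * (p ∸ k)! but neither factorial.
  prime∣pCk : ∀ {k} → 0 < k → k < p → p ∣ p C k
  prime∣pCk {k} 0<k k<p with euclidsLemma (p C k) (k ! * (p ∸ k) !) p-prime p∣pCk*k!*[p∸k]!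
    where
    p∣pCk*k!*[p∸k]! : p ∣ (p C k) * (k ! * (p ∸ k) !)
    p∣pCk*k!*[p∸k]! = subst (p ∣_) (sym (nCk*[k!*[n∸k]!]≡n! (<⇒≤ k<p))) (n∣n! p {{prime⇒nonZero p-prime}})
  ... | inj₁ p∣pCk       = p∣pCk
  ... | inj₂ p∣k!*[p∸k]! =
    contradiction p∣k!*[p∸k]! (prime∤* (prime∤! k<p) (prime∤! (∸-monoʳ-< {p} {k} {0} 0<k (<⇒≤ k<p))))

private
  module ℕ-Exp = Algebra.Properties.Semiring.Exp +-*-semiring
  module ℕ-Mult = Algebra.Properties.Semiring.Mult +-*-semiring
  module ℕ-Sum = Algebra.Properties.Monoid.Sum +-0-monoid
  module ℕ-Binomial = Algebra.Properties.CommutativeSemiring.Binomial +-*-commutativeSemiring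

^-semiring≡^ : ∀ x n → x ℕ-Exp.^ n ≡ x ^ n
^-semiring≡^ x zero    = refl
^-semiring≡^ x (suc n) = cong (x *_) (^-semiring≡^ x n)

×≡* : ∀ k x → k ℕ-Mult.× x ≡ k * x
×≡* zero    x = refl
×≡* (suc k) x = cong (x +_) (×≡* k x)

binomialTerm[x,1]≡nCk*x^k : ∀ x n k → ℕ-Binomial.binomialTerm x 1 n k ≡ (n C toℕ k) * x ^ toℕ k
binomialTerm[x,1]≡nCk*x^k x n k = begin
  (n C toℕ k) ℕ-Mult.× (x ℕ-Exp.^ toℕ k * 1 ℕ-Exp.^ (n ∸ toℕ k))
    ≡⟨ ×≡* (n C toℕ k) _ ⟩
  (n C toℕ k) * (x ℕ-Exp.^ toℕ k * 1 ℕ-Exp.^ (n ∸ toℕ k))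
    ≡⟨ cong ((n C toℕ k) *_) (cong₂ _*_ (^-semiring≡^ x (toℕ k)) 1^≡1) ⟩
  (n C toℕ k) * (x ^ toℕ k * 1)
    ≡⟨ cong ((n C toℕ k) *_) (*-identityʳ (x ^ toℕ k)) ⟩
  (n C toℕ k) * x ^ toℕ k
    ∎
  where
  open ≡-Reasoning
  1^≡1 : 1 ℕ-Exp.^ (n ∸ toℕ k) ≡ 1
  1^≡1 = trans (^-semiring≡^ 1 (n ∸ toℕ k)) (^-zeroˡ (n ∸ toℕ k))

binomialTerm[x,1,n,n]≡x^n : ∀ x n → ℕ-Binomial.binomialTerm x 1 n (fromℕ n) ≡ x ^ n
binomialTerm[x,1,n,n]≡x^n x n = begin
  ℕ-Binomial.binomialTerm x 1 n (fromℕ n) ≡⟨ binomialTerm[x,1]≡nCk*x^k x n (fromℕ n) ⟩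
  (n C toℕ (fromℕ n)) * x ^ toℕ (fromℕ n) ≡⟨ cong (λ k → (n C k) * x ^ k) (toℕ-fromℕ n) ⟩
  (n C n) * x ^ n                         ≡⟨ cong (_* x ^ n) (nCn≡1 n) ⟩
  1 * x ^ n                               ≡⟨ *-identityˡ (x ^ n) ⟩
  x ^ n                                   ∎
  where open ≡-Reasoning

∣-sum : ∀ {d n} (t : Fin n → ℕ) → (∀ i → d ∣ t i) → d ∣ ℕ-Sum.sum t
∣-sum {d} {zero}  t d∣t = d ∣0
∣-sum {d} {suc n} t d∣t = ∣m∣n⇒∣m+n (d∣t zero) (∣-sum (λ i → t (suc i)) (λ i → d∣t (suc i)))

-- Only the two extreme terms of the binomial expansion survive modulo d.
[x+1]^n≈x^n+1 : ∀ {d} n .{{_ : NonZero n}} → (∀ {k} → 0 < k → k < n → d ∣ n C k) →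
                ∀ x → (x + 1) ^ n ≈ x ^ n + 1 [mod d ]
[x+1]^n≈x^n+1 {d} (suc m) d∣nCk x = begin
  (x + 1) ^ n
    ≡⟨ ^-semiring≡^ (x + 1) n ⟨
  (x + 1) ℕ-Exp.^ n
    ≡⟨ ℕ-Binomial.theorem n x 1 ⟩
  term zero + ℕ-Sum.sum inner
    ≡⟨ cong₂ _+_ first≡1 (ℕ-Sum.sum-init-last inner) ⟩
  1 + (ℕ-Sum.sum (λ i → inner (inject₁ i)) + inner (fromℕ m))
    ≈⟨ +-cong-mod ≈-mod-refl (+-cong-mod middle≈0 last≈x^n) ⟩
  1 + (0 + x ^ n)
    ≡⟨ +-comm 1 (x ^ n) ⟩
  x ^ n + 1
    ∎
  where
  open SetoidReasoning ≈-mod-setoid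
  n : ℕ
  n = suc m
  term : Fin (suc n) → ℕ
  term = ℕ-Binomial.binomialTerm x 1 n
  inner : Fin n → ℕ
  inner i = term (suc i)
  first≡1 : term zero ≡ 1
  first≡1 = binomialTerm[x,1]≡nCk*x^k x n zero
  d∣middle : ∀ i → d ∣ inner (inject₁ i)
  d∣middle i = subst (d ∣_) (sym (binomialTerm[x,1]≡nCk*x^k x n (suc (inject₁ i))))
    (∣m⇒∣m*n _ (d∣nCk z<s (s≤s (subst (_< m) (sym (toℕ-inject₁ i)) (toℕ<n i)))))
  middle≈0 : ℕ-Sum.sum (λ i → inner (inject₁ i)) ≈ 0 [mod d ]
  middle≈0 = ∣⇒≈0-mod (∣-sum _ d∣middle)
  last≈x^n : inner (fromℕ m) ≈ x ^ n [mod d ]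
  last≈x^n = ≡⇒≈-mod (binomialTerm[x,1,n,n]≡x^n x n)

x^p≈x : ∀ {p} → Prime p → ∀ x → x ^ p ≈ x [mod p ]
x^p≈x {zero}  p-prime = contradiction p-prime ¬prime[0]
x^p≈x {suc m} p-prime zero    = ≈-mod-refl
x^p≈x {suc m} p-prime (suc x) = begin
  suc x ^ suc m     ≡⟨ cong (_^ suc m) (+-comm 1 x) ⟩
  (x + 1) ^ suc m   ≈⟨ [x+1]^n≈x^n+1 (suc m) (prime∣pCk p-prime) x ⟩
  x ^ suc m + 1     ≈⟨ +-cong-mod (x^p≈x p-prime x) ≈-mod-refl ⟩
  x + 1             ≡⟨ +-comm x 1 ⟩
  suc x             ∎
  where open SetoidReasoning ≈-mod-setoid

module _ {p : ℕ} (p-prime : Prime p) where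

  *-cancelʳ-≈-mod : ∀ {x y z} → p ∤ z → x * z ≈ y * z [mod p ] → x ≈ y [mod p ]
  *-cancelʳ-≈-mod {x} {y} {z} p∤z x*z≈y*z =
    [ ∣∣-∣⇒≈-mod , (λ p∣z → contradiction p∣z p∤z) ]′ (euclidsLemma ∣ x - y ∣ z p-prime
      (subst (p ∣_) (sym (*-distribʳ-∣-∣ z x y)) (≈-mod⇒∣∣-∣ x*z≈y*z)))

  fermat : ∀ {x} → p ∤ x → x ^ (p ∸ 1) ≈ 1 [mod p ]
  fermat {x} p∤x = *-cancelʳ-≈-mod p∤x (begin
    x ^ (p ∸ 1) * x ≡⟨ *-comm (x ^ (p ∸ 1)) x ⟩
    x ^ suc (p ∸ 1) ≡⟨ cong (x ^_) (suc-pred p {{prime⇒nonZero p-prime}}) ⟩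
    x ^ p           ≈⟨ x^p≈x p-prime x ⟩
    x               ≡⟨ *-identityˡ x ⟨
    1 * x           ∎)
    where open SetoidReasoning ≈-mod-setoid

  ^-+-*-≈-mod : ∀ {x} → p ∤ x → ∀ n k → x ^ (n + k * (p ∸ 1)) ≈ x ^ n [mod p ]
  ^-+-*-≈-mod {x} p∤x n k = begin
    x ^ (n + k * (p ∸ 1))     ≡⟨ ^-distribˡ-+-* x n (k * (p ∸ 1)) ⟩
    x ^ n * x ^ (k * (p ∸ 1)) ≡⟨ cong (λ e → x ^ n * x ^ e) (*-comm k (p ∸ 1)) ⟩
    x ^ n * x ^ ((p ∸ 1) * k) ≡⟨ cong (x ^ n *_) (^-*-assoc x (p ∸ 1) k) ⟨
    x ^ n * (x ^ (p ∸ 1)) ^ k ≈⟨ *-cong-mod (≈-mod-refl {x = x ^ n}) (^-congˡ-mod k (fermat p∤x)) ⟩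
    x ^ n * 1 ^ k             ≡⟨ cong (x ^ n *_) (^-zeroˡ k) ⟩
    x ^ n * 1                 ≡⟨ *-identityʳ (x ^ n) ⟩
    x ^ n                     ∎
    where open SetoidReasoning ≈-mod-setoid

  ^-cong-exponent-mod : ∀ {x i j} → p ∤ x → i ≈ j [mod p ∸ 1 ] → x ^ i ≈ x ^ j [mod p ]
  ^-cong-exponent-mod {x} {i} {j} p∤x i≈j with ≤-total j i
  ... | inj₁ j≤i = let k , i≡j+k*c = ≈-mod⇒≡+* j≤i i≈j in
    ≈-mod-trans (≡⇒≈-mod (cong (x ^_) i≡j+k*c)) (^-+-*-≈-mod p∤x j k)
  ... | inj₂ i≤j = let k , j≡i+k*c = ≈-mod⇒≡+* i≤j (≈-mod-sym i≈j) in
    ≈-mod-sym (≈-mod-trans (≡⇒≈-mod (cong (x ^_) j≡i+k*c)) (^-+-*-≈-mod p∤x i k))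

-- Natural combinations modulo c

-- The coefficients are natural numbers because they serve as exponents.
record Combination (c h a n : ℕ) : Set where
  constructor combination
  field
    u v       : ℕ
    u*h+v*a≈n : u * h + v * a ≈ n [mod c ]

module _ {c h a : ℕ} where

  combination-resp : ∀ {m n} → m ≈ n [mod c ] → Combination c h a m → Combination c h a n
  combination-resp m≈n (combination u v u*h+v*a≈m) = combination u v (≈-mod-trans u*h+v*a≈m m≈n)

  combination-h : Combination c h a h
  combination-h = combination 1 0 (≡⇒≈-mod (identity h a))
    where
    identity : ∀ h a → 1 * h + 0 * a ≡ h
    identity = solve-∀

  combination-a : Combination c h a a
  combination-a = combination 0 1 (≡⇒≈-mod (identity h a))
    where
    identity : ∀ h a → 0 * h + 1 * a ≡ a
    identity = solve-∀

  combination-c : Combination c h a c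
  combination-c = combination 0 0 (≈-mod-sym (∣⇒≈0-mod ∣-refl))

  combination-+ : ∀ {m n} → Combination c h a m → Combination c h a n → Combination c h a (m + n)
  combination-+ (combination u v u*h+v*a≈m) (combination u′ v′ u′*h+v′*a≈n) =
    combination (u + u′) (v + v′)
      (≈-mod-trans (≡⇒≈-mod (distrib u v u′ v′ h a)) (+-cong-mod u*h+v*a≈m u′*h+v′*a≈n))
    where
    distrib : ∀ u v u′ v′ h a → (u + u′) * h + (v + v′) * a ≡ (u * h + v * a) + (u′ * h + v′ * a)
    distrib = solve-∀

  combination-* : ∀ k {n} → Combination c h a n → Combination c h a (k * n)
  combination-* k (combination u v u*h+v*a≈n) =
    combination (k * u) (k * v)
      (≈-mod-trans (≡⇒≈-mod (distrib k u v h a)) (*-cong-mod (≈-mod-refl {x = k}) u*h+v*a≈n))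
    where
    distrib : ∀ k u v h a → k * u * h + k * v * a ≡ k * (u * h + v * a)
    distrib = solve-∀

  -- Adding (c ∸ 1) * w to d + w gives d + w * c, which is d modulo c.
  combination-∸ : .{{_ : NonZero c}} → ∀ {d w} →
                  Combination c h a (d + w) → Combination c h a w → Combination c h a d
  combination-∸ {d} {w} comb[d+w] comb[w] =
    combination-resp d+w+[c∸1]*w≈d (combination-+ comb[d+w] (combination-* (c ∸ 1) comb[w]))
    where
    rearrange : ∀ d w c′ → d + w + c′ * w ≡ d + w * (1 + c′)
    rearrange = solve-∀
    d+w+[c∸1]*w≈d : d + w + (c ∸ 1) * w ≈ d [mod c ]
    d+w+[c∸1]*w≈d = ≈-mod-trans
      (≡⇒≈-mod (trans (rearrange d w (c ∸ 1)) (cong (λ e → d + w * e) (suc-pred c)))) (+-*-≈-mod d w)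

  combination-gcd : .{{_ : NonZero c}} → ∀ {m n} →
                    Combination c h a m → Combination c h a n → Combination c h a (gcd m n)
  combination-gcd {m} {n} comb[m] comb[n] with Bézout.identity (gcd-GCD m n)
  ... | Bézout.+- x y g+y*n≡x*m =
    combination-∸ (subst (Combination c h a) (sym g+y*n≡x*m) (combination-* x comb[m])) (combination-* y comb[n])
  ... | Bézout.-+ x y g+x*m≡y*n =
    combination-∸ (subst (Combination c h a) (sym g+x*m≡y*n) (combination-* y comb[n])) (combination-* x comb[m])

  combination-gcd₃ : .{{_ : NonZero c}} → Combination c h a (gcd (gcd h a) c)
  combination-gcd₃ = combination-gcd (combination-gcd combination-h combination-a) combination-c

-- Solving g ^ h ≡ a and g ^ a ≡ h

gcd[gcd[m,n],c]≡1 : ∀ m n c → gcd m c ≡ 1 ⊎ gcd n c ≡ 1 → gcd (gcd m n) c ≡ 1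
gcd[gcd[m,n],c]≡1 m n c (inj₁ gcd[m,c]≡1) = ∣1⇒≡1 (subst (gcd (gcd m n) c ∣_) gcd[m,c]≡1
  (gcd-greatest (∣-trans (gcd[m,n]∣m (gcd m n) c) (gcd[m,n]∣m m n)) (gcd[m,n]∣n (gcd m n) c)))
gcd[gcd[m,n],c]≡1 m n c (inj₂ gcd[n,c]≡1) = ∣1⇒≡1 (subst (gcd (gcd m n) c ∣_) gcd[n,c]≡1
  (gcd-greatest (∣-trans (gcd[m,n]∣m (gcd m n) c) (gcd[m,n]∣n m n)) (gcd[m,n]∣n (gcd m n) c)))

^-distribʳ-* : ∀ x y n → (x * y) ^ n ≡ x ^ n * y ^ n
^-distribʳ-* x y zero    = refl
^-distribʳ-* x y (suc n) = trans (cong ((x * y) *_) (^-distribʳ-* x y n)) (interchange x y (x ^ n) (y ^ n))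
  where
  interchange : ∀ x y X Y → x * y * (X * Y) ≡ x * X * (y * Y)
  interchange = solve-∀

[x^m]^n≡[x^n]^m : ∀ x m n → (x ^ m) ^ n ≡ (x ^ n) ^ m
[x^m]^n≡[x^n]^m x m n = trans (^-*-assoc x m n) (trans (cong (x ^_) (*-comm m n)) (sym (^-*-assoc x n m)))

x^[u*h+v*a]≡[x^h]^u*[x^a]^v : ∀ x u h v a → x ^ (u * h + v * a) ≡ (x ^ h) ^ u * (x ^ a) ^ v
x^[u*h+v*a]≡[x^h]^u*[x^a]^v x u h v a = begin
  x ^ (u * h + v * a)          ≡⟨ ^-distribˡ-+-* x (u * h) (v * a) ⟩
  x ^ (u * h) * x ^ (v * a)    ≡⟨ cong₂ _*_ (cong (x ^_) (*-comm u h)) (cong (x ^_) (*-comm v a)) ⟩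
  x ^ (h * u) * x ^ (a * v)    ≡⟨ cong₂ _*_ (^-*-assoc x h u) (^-*-assoc x a v) ⟨
  (x ^ h) ^ u * (x ^ a) ^ v    ∎
  where open ≡-Reasoning

[x^u*y^v]^s≡[x^s]^u*[y^s]^v : ∀ x y u v s → (x ^ u * y ^ v) ^ s ≡ (x ^ s) ^ u * (y ^ s) ^ v
[x^u*y^v]^s≡[x^s]^u*[y^s]^v x y u v s =
  trans (^-distribʳ-* (x ^ u) (y ^ v) s) (cong₂ _*_ ([x^m]^n≡[x^n]^m x u s) ([x^m]^n≡[x^n]^m y v s))

module _ {m : ℕ} where

  triple⇒h^h≈a^a : ∀ {g h a} → g ^ h ≈ a [mod m ] → g ^ a ≈ h [mod m ] → h ^ h ≈ a ^ a [mod m ]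
  triple⇒h^h≈a^a {g} {h} {a} g^h≈a g^a≈h = begin
    h ^ h       ≈⟨ ^-congˡ-mod h g^a≈h ⟨
    (g ^ a) ^ h ≡⟨ [x^m]^n≡[x^n]^m g a h ⟩
    (g ^ h) ^ a ≈⟨ ^-congˡ-mod a g^h≈a ⟩
    a ^ a       ∎
    where open SetoidReasoning ≈-mod-setoid

module _ {p h a : ℕ} (p-prime : Prime p) (comb : Combination (p ∸ 1) h a 1) where

  open Combination comb

  x≈[x^h]^u*[x^a]^v : ∀ {x} → p ∤ x → x ≈ (x ^ h) ^ u * (x ^ a) ^ v [mod p ]
  x≈[x^h]^u*[x^a]^v {x} p∤x = begin
    x                         ≡⟨ ^-identityʳ x ⟨
    x ^ 1                     ≈⟨ ^-cong-exponent-mod p-prime p∤x u*h+v*a≈n ⟨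
    x ^ (u * h + v * a)       ≡⟨ x^[u*h+v*a]≡[x^h]^u*[x^a]^v x u h v a ⟩
    (x ^ h) ^ u * (x ^ a) ^ v ∎
    where open SetoidReasoning ≈-mod-setoid

  ≈-mod-from-powers : ∀ {x y} → p ∤ x → p ∤ y →
                      x ^ h ≈ y ^ h [mod p ] → x ^ a ≈ y ^ a [mod p ] → x ≈ y [mod p ]
  ≈-mod-from-powers {x} {y} p∤x p∤y x^h≈y^h x^a≈y^a = begin
    x                         ≈⟨ x≈[x^h]^u*[x^a]^v p∤x ⟩
    (x ^ h) ^ u * (x ^ a) ^ v ≈⟨ *-cong-mod (^-congˡ-mod u x^h≈y^h) (^-congˡ-mod v x^a≈y^a) ⟩
    (y ^ h) ^ u * (y ^ a) ^ v ≈⟨ x≈[x^h]^u*[x^a]^v p∤y ⟨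
    y                         ∎
    where open SetoidReasoning ≈-mod-setoid

  module _ (p∤h : p ∤ h) (p∤a : p ∤ a) (h^h≈a^a : h ^ h ≈ a ^ a [mod p ]) where

    [a^u*h^v]^h≈a : (a ^ u * h ^ v) ^ h ≈ a [mod p ]
    [a^u*h^v]^h≈a = begin
      (a ^ u * h ^ v) ^ h       ≡⟨ [x^u*y^v]^s≡[x^s]^u*[y^s]^v a h u v h ⟩
      (a ^ h) ^ u * (h ^ h) ^ v ≈⟨ *-cong-mod (≈-mod-refl {x = (a ^ h) ^ u}) (^-congˡ-mod v h^h≈a^a) ⟩
      (a ^ h) ^ u * (a ^ a) ^ v ≈⟨ x≈[x^h]^u*[x^a]^v p∤a ⟨
      a                         ∎
      where open SetoidReasoning ≈-mod-setoid

    [a^u*h^v]^a≈h : (a ^ u * h ^ v) ^ a ≈ h [mod p ]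
    [a^u*h^v]^a≈h = begin
      (a ^ u * h ^ v) ^ a       ≡⟨ [x^u*y^v]^s≡[x^s]^u*[y^s]^v a h u v a ⟩
      (a ^ a) ^ u * (h ^ a) ^ v ≈⟨ *-cong-mod (^-congˡ-mod u h^h≈a^a) (≈-mod-refl {x = (h ^ a) ^ v}) ⟨
      (h ^ h) ^ u * (h ^ a) ^ v ≈⟨ x≈[x^h]^u*[x^a]^v p∤h ⟨
      h                         ∎
      where open SetoidReasoning ≈-mod-setoid

module _ {p : ℕ} (p-prime : Prime p) where

  private instance
    p≢0 : NonZero p
    p≢0 = prime⇒nonZero p-prime

  inUnits⇒< : ∀ {x} → InUnits p x → x < p
  inUnits⇒< (_ , x≤p∸1) = subst (_ <_) (suc-pred p) (s≤s x≤p∸1)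

  inUnits⇒∤ : ∀ {x} → InUnits p x → p ∤ x
  inUnits⇒∤ {suc _} x∈ = >⇒∤ (inUnits⇒< x∈)

  ∤⇒%-inUnits : ∀ {x} → p ∤ x → InUnits p (x % p)
  ∤⇒%-inUnits {x} p∤x = n≢0⇒n>0 x%p≢0 , <⇒≤pred (m%n<n x p)
    where
    x%p≢0 : x % p ≢ 0
    x%p≢0 x%p≡0 = p∤x (≈0-mod⇒∣ (≈-mod-trans (≈-mod-sym (%-≈-mod x)) (≡⇒≈-mod x%p≡0)))

  module _ {h a : ℕ} (h∈ : InUnits p h) (a∈ : InUnits p a) (comb : Combination (p ∸ 1) h a 1) where

    private
      p∤h : p ∤ h
      p∤h = inUnits⇒∤ h∈
      p∤a : p ∤ a
      p∤a = inUnits⇒∤ a∈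
      triple⇒≈ : ∀ {g} → Triple p g h a → g ^ h ≈ a [mod p ] × g ^ a ≈ h [mod p ]
      triple⇒≈ (g^h≡a , g^a≡h) = mod g^h≡a , mod g^a≡h

    triple⇒h^h≡a^a : (Σ ℕ λ g → InUnits p g × Triple p g h a) → (h ^ h) ≡ (a ^ a) [mod p ]
    triple⇒h^h≡a^a (g , _ , t) = let g^h≈a , g^a≈h = triple⇒≈ {g} t in unmod (triple⇒h^h≈a^a g^h≈a g^a≈h)

    h^h≡a^a⇒triple : (h ^ h) ≡ (a ^ a) [mod p ] → Σ ℕ λ g → InUnits p g × Triple p g h a
    h^h≡a^a⇒triple h^h≡a^a = g₀ % p , ∤⇒%-inUnits p∤g₀ , unmod [g₀%p]^h≈a , unmod [g₀%p]^a≈h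
      where
      open Combination comb
      h^h≈a^a : h ^ h ≈ a ^ a [mod p ]
      h^h≈a^a = mod h^h≡a^a
      g₀ : ℕ
      g₀ = a ^ u * h ^ v
      p∤g₀ : p ∤ g₀
      p∤g₀ = prime∤* p-prime (prime∤^ p-prime p∤a u) (prime∤^ p-prime p∤h v)
      [g₀%p]^h≈a : (g₀ % p) ^ h ≈ a [mod p ]
      [g₀%p]^h≈a = ≈-mod-trans (^-congˡ-mod h (%-≈-mod g₀)) ([a^u*h^v]^h≈a p-prime comb p∤h p∤a h^h≈a^a)
      [g₀%p]^a≈h : (g₀ % p) ^ a ≈ h [mod p ]
      [g₀%p]^a≈h = ≈-mod-trans (^-congˡ-mod a (%-≈-mod g₀)) ([a^u*h^v]^a≈h p-prime comb p∤h p∤a h^h≈a^a)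

    triple-unique : (g g′ : ℕ) → InUnits p g → Triple p g h a → InUnits p g′ → Triple p g′ h a → g ≡ g′
    triple-unique g g′ g∈ t g′∈ t′ =
      let g^h≈a , g^a≈h = triple⇒≈ {g} t ; g′^h≈a , g′^a≈h = triple⇒≈ {g′} t′ in
      ≈-mod⇒≡ (inUnits⇒< g∈) (inUnits⇒< g′∈) (≈-mod-from-powers p-prime comb (inUnits⇒∤ g∈) (inUnits⇒∤ g′∈)
        (≈-mod-trans g^h≈a (≈-mod-sym g′^h≈a)) (≈-mod-trans g^a≈h (≈-mod-sym g′^a≈h)))

proposition9 : (p : ℕ) → Prime p →
    ((h a : ℕ) → InUnits p h → InUnits p a → Gcd3One h a p →
      (((h ^ h) ≡ (a ^ a) [mod p ]) ⇔ (Σ ℕ λ g → InUnits p g × Triple p g h a))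
      × ((g g′ : ℕ) → InUnits p g → Triple p g h a → InUnits p g′ → Triple p g′ h a → g ≡ g′))
    × ((h a : ℕ) → InUnits p h → InUnits p a → (gcd h (p ∸ 1) ≡ 1 ⊎ gcd a (p ∸ 1) ≡ 1) →
      (((h ^ h) ≡ (a ^ a) [mod p ]) ⇔ (Σ ℕ λ g → InUnits p g × Triple p g h a))
      × ((g g′ : ℕ) → InUnits p g → Triple p g h a → InUnits p g′ → Triple p g′ h a → g ≡ g′))
proposition9 p p-prime =
    (λ h a h∈ a∈ gcd₃≡1 → solution h∈ a∈ (combination-1 gcd₃≡1))
  , (λ h a h∈ a∈ coprime → solution h∈ a∈ (combination-1 (gcd[gcd[m,n],c]≡1 h a (p ∸ 1) coprime)))
  where
  instance
    p∸1≢0 : NonZero (p ∸ 1)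
    p∸1≢0 = >-nonZero (pred-mono-< (nonTrivial⇒n>1 p {{prime⇒nonTrivial p-prime}}))

  combination-1 : ∀ {h a} → Gcd3One h a p → Combination (p ∸ 1) h a 1
  combination-1 gcd₃≡1 = combination-resp (≡⇒≈-mod gcd₃≡1) combination-gcd₃

  solution : ∀ {h a} → InUnits p h → InUnits p a → Combination (p ∸ 1) h a 1 →
    (((h ^ h) ≡ (a ^ a) [mod p ]) ⇔ (Σ ℕ λ g → InUnits p g × Triple p g h a))
    × ((g g′ : ℕ) → InUnits p g → Triple p g h a → InUnits p g′ → Triple p g′ h a → g ≡ g′)
  solution h∈ a∈ comb =
      mk⇔ (h^h≡a^a⇒triple p-prime h∈ a∈ comb) (triple⇒h^h≡a^a p-prime h∈ a∈ comb)
    , triple-unique p-prime h∈ a∈ comb
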